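{- Let $a\in\mathbb{N}^*$ and let $C\in\mathcal{H}^c_{a,\infty}$. Then there exists a spanning tree of $\mathcal{G}(C)$ containing two adjacent vertices such that the number of edges of the spanning tree outgoing from this pair of vertices is at most $a$.
   Context: Clauses are function-free second-order Horn clauses. - An atom $P(x_{k_1},\dots,x_{k_a})$ consists of a predicate variable $P$ of arity $a\ge1$ applied to $a$ term variables. - A clause has at most one positive literal (the head) and finitely many negative literals (the body). - $\mathcal{H}^c_{a,\infty}$ is the set of such clauses in which every literal has arity at most $a$ and which are connected: the literals cannot be partitioned into two non-empty sets such that the variables in one set are disjoint from those in the other. The graph $\mathcal{G}(C)$ is an undirected, edge-labeled graph. - Its vertices are in bijection with the predicate-variable occurrences (literals, head and body) of $C$. - For each pair of literals and each term variable they share, there is an edge between the corresponding vertices, labeled with that variable. - An edge outgoing from a set of vertices is an edge with exactly one endpoint in that set. -}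

module Defs where

open import Data.Nat using (ℕ; _≤_; _<_)
open import Data.Fin using (Fin; _≟_) renaming (_<_ to _<ᶠ_)
open import Data.List using (List; []; _∷_; length; lookup; filter)
open import Data.List.Membership.Propositional using (_∈_)
open import Data.List.Relation.Unary.All using (All)
open import Data.List.Relation.Unary.Unique.Propositional using (Unique)
open import Data.Maybe using (Maybe; just; nothing)
open import Data.Bool using (Bool; true; false; _∨_; _xor_)
open import Data.Product using (Σ; ∃; _×_; _,_)
open import Data.Sum using (_⊎_)
open import Relation.Binary.PropositionalEquality using (_≡_)
open import Relation.Nullary using (¬_)
open import Relation.Nullary.Decidable using (⌊_⌋)

-- Predicate variables and term variables are named by natural numbers.
-- A literal P(x_{k1},...,x_{ka}): predicate variable and list of term variables
-- (its arity is the length of the list).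
record Literal : Set where
  constructor lit
  field
    pred : ℕ
    args : List ℕ
open Literal public

-- A Horn clause: at most one positive literal (head), finitely many body literals.
record Clause : Set where
  constructor clause
  field
    head : Maybe Literal
    body : List Literal
open Clause public

literals : Clause → List Literal
literals (clause nothing b) = b
literals (clause (just h) b) = h ∷ b

-- number of literal occurrences = number of vertices of G(C)
nLits : Clause → ℕ
nLits C = length (literals C)

litAt : (C : Clause) → Fin (nLits C) → Literal
litAt C i = lookup (literals C) i

Shares : (C : Clause) → Fin (nLits C) → Fin (nLits C) → ℕ → Set
Shares C i j x = (x ∈ args (litAt C i)) × (x ∈ args (litAt C j))

IsConnectedClause : Clause → Set
IsConnectedClause C =
  (S : Fin (nLits C) → Bool) →
  (∃ λ i → S i ≡ true) → (∃ λ j → S j ≡ false) →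
  ∃ λ i → ∃ λ j → ∃ λ x → S i ≡ true × S j ≡ false × Shares C i j x

ArityOK : ℕ → Literal → Set
ArityOK a L = (1 ≤ length (args L)) × (length (args L) ≤ a)

InHc : ℕ → Clause → Set
InHc a C = All (ArityOK a) (literals C) × IsConnectedClause C

-- Edges of the multigraph G(C): an edge between vertices src < tgt labeled
-- with a shared term variable lbl (one edge per shared variable).
record Edge (n : ℕ) : Set where
  constructor edge
  field
    src : Fin n
    tgt : Fin n
    lbl : ℕ
open Edge public

IsEdgeOfG : (C : Clause) → Edge (nLits C) → Set
IsEdgeOfG C e = (src e <ᶠ tgt e) × Shares C (src e) (tgt e) (lbl e)

Joins : ∀ {n} → Edge n → Fin n → Fin n → Set
Joins e u w = (src e ≡ u × tgt e ≡ w) ⊎ (src e ≡ w × tgt e ≡ u)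

data Walk {n : ℕ} (T : List (Edge n)) : Fin n → Fin n → Set where
  []   : ∀ {u} → Walk T u u
  step : ∀ {u w v} (e : Edge n) → e ∈ T → Joins e u w → Walk T w v → Walk T u v

edgesOf : ∀ {n} {T : List (Edge n)} {u v} → Walk T u v → List (Edge n)
edgesOf [] = []
edgesOf (step e _ _ p) = e ∷ edgesOf p

Acyclic : ∀ {n} → List (Edge n) → Set
Acyclic {n} T = ∀ (u : Fin n) (p : Walk T u u) → Unique (edgesOf p) → edgesOf p ≡ []

IsSpanningTree : (C : Clause) → List (Edge (nLits C)) → Set
IsSpanningTree C T =
  All (IsEdgeOfG C) T × Unique T ×
  (∀ u v → Walk T u v) × Acyclic T

inPair : ∀ {n} → Fin n → Fin n → Fin n → Bool
inPair u v w = ⌊ w ≟ u ⌋ ∨ ⌊ w ≟ v ⌋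

outgoing : ∀ {n} → Fin n → Fin n → Edge n → Bool
outgoing u v e = inPair u v (src e) xor inPair u v (tgt e)

nOutgoing : ∀ {n} → Fin n → Fin n → List (Edge n) → ℕ
nOutgoing u v [] = 0
nOutgoing u v (e ∷ T) with outgoing u v e
... | true  = Data.Nat.suc (nOutgoing u v T)
... | false = nOutgoing u v T

module Submission where

-- Grow a spanning tree of G(C) from a root, always attaching a vertex j not yet
-- reached (one shares a variable with the tree, by connectedness) to the most
-- recently reached vertex k sharing a variable x with j, by the edge labelled x.
-- Then the children of a vertex v are attached by pairwise distinct variables of v:
-- if two children used the same x, the later one would share x with the earlier
-- one, which was reached after v and so would have been preferred to v.
-- Let u be the last vertex attached and v its parent. As u is a leaf, the edges
-- leaving {u, v} are those at v other than {u, v}: at most one edge to the parent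
-- of v, and the edges to the other children of v. Their number is at most the
-- number of children of v, hence at most the arity of v, hence at most a.

open import Defs
open import Data.Bool using (Bool; true; false; _xor_)
import Data.Bool.Properties as Boolₚ
open import Data.Empty using (⊥; ⊥-elim)
open import Data.Fin as Fin using (Fin)
import Data.Fin.Properties as Finₚ
open import Data.List using (List; []; _∷_; _++_; length; map; filter; allFin)
import Data.List.Properties as Listₚ
open import Data.List.Membership.Propositional using (_∈_; _∉_; find; lose)
import Data.List.Membership.DecPropositional as DecMembership
open import Data.List.Membership.Propositional.Properties
  using (∈-allFin; ∈-map⁻; ∈-filter⁻; ∈-++⁺ʳ; ∈-lookup)
open import Data.List.Relation.Unary.All as All using (All; []; _∷_)
import Data.List.Relation.Unary.All.Properties as All
open import Data.List.Relation.Unary.Any as Any using (Any; here; there; _─_)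
open import Data.List.Relation.Unary.First as First using (First; [_]; _∷_)
open import Data.List.Relation.Unary.Unique.Propositional using (Unique; []; _∷_)
open import Data.Nat as ℕ using (ℕ; _≤_)
import Data.Nat.Properties as ℕₚ
open import Algebra.Properties.CommutativeSemigroup ℕₚ.+-commutativeSemigroup using (interchange)
open import Data.Product as Product using (Σ; ∃; _×_; _,_; proj₁; proj₂)
open import Data.Sum as Sum using (_⊎_; inj₁; inj₂)
open import Function using (_∘_)
open import Level using (0ℓ)
open import Relation.Binary.PropositionalEquality hiding ([_])
open import Relation.Nullary using (¬_; Dec; yes; no; does; proof; contradiction)
open import Relation.Nullary.Decidable using (isYes≗does; dec-true; dec-false; toSum)
open import Relation.Nullary.Reflects using (Reflects; invert)
open import Relation.Unary using (Pred; Decidable)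

private variable
  A : Set
  x y : A
  xs ys : List A

∈-─⁺ : (x∈ys : x ∈ ys) → y ∈ ys → y ≢ x → y ∈ (ys ─ x∈ys)
∈-─⁺ (here refl) (here refl) y≢x = contradiction refl y≢x
∈-─⁺ (here _)    (there y∈)  _   = y∈
∈-─⁺ (there _)   (here y≡)   _   = here y≡
∈-─⁺ (there x∈)  (there y∈)  y≢x = there (∈-─⁺ x∈ y∈ y≢x)

Unique⇒length-≤ : Unique xs → (∀ {z} → z ∈ xs → z ∈ ys) → length xs ≤ length ys
Unique⇒length-≤ [] _ = ℕ.z≤n
Unique⇒length-≤ {xs = x ∷ xs} {ys} (x∉xs ∷ xs!) xs⊆ys = begin
  ℕ.suc (length xs)          ≤⟨ ℕ.s≤s (Unique⇒length-≤ xs! (λ z∈ →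
                                  ∈-─⁺ x∈ys (xs⊆ys (there z∈)) (≢-sym (All.lookup x∉xs z∈)))) ⟩
  ℕ.suc (length (ys ─ x∈ys)) ≡⟨ Listₚ.length-removeAt′ ys (Any.index x∈ys) ⟨
  length ys                  ∎
  where
  open ℕₚ.≤-Reasoning
  x∈ys = xs⊆ys (here refl)

Unique⇒complete : ∀ {n} {xs : List (Fin n)} → Unique xs → n ≤ length xs → ∀ w → w ∈ xs
Unique⇒complete {n} {xs} xs! n≤∣xs∣ w with DecMembership._∈?_ Fin._≟_ w xs
... | yes w∈xs = w∈xs
... | no  w∉xs = contradiction n≤∣xs∣ (ℕₚ.<⇒≱ (begin-strict
  length xs              <⟨ Unique⇒length-≤ (w∉ ∷ xs!) (λ {z} _ → ∈-allFin z) ⟩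
  length (allFin n)      ≡⟨ Listₚ.length-tabulate (λ z → z) ⟩
  n                      ∎))
  where
  open ℕₚ.≤-Reasoning
  w∉ : All (w ≢_) xs
  w∉ = All.tabulate λ z∈ w≡z → w∉xs (subst (_∈ xs) (sym w≡z) z∈)

First-precedes : ∀ {P : Pred A 0ℓ} → x ≢ y → First P (y ≡_) xs → First (y ≢_) (x ≡_) xs → P x
First-precedes x≢y [ refl ]  [ x≡y ]   = contradiction x≡y x≢y
First-precedes x≢y [ refl ]  (y≢y ∷ _) = contradiction refl y≢y
First-precedes x≢y (pz ∷ _)  [ refl ]  = pz
First-precedes x≢y (_ ∷ f)   (_ ∷ g)   = First-precedes x≢y f g

First-witness : ∀ {P Q : Pred A 0ℓ} → First P Q xs → ∃ λ y → Q y × First P (y ≡_) xs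
First-witness [ qy ] = _ , qy , [ refl ]
First-witness (px ∷ f) with First-witness f
... | y , qy , f′ = y , qy , px ∷ f′

does-true⇒ : (a? : Dec A) → does a? ≡ true → A
does-true⇒ a? does≡ = invert (subst (Reflects _) does≡ (proof a?))

does-false⇒ : (a? : Dec A) → does a? ≡ false → ¬ A
does-false⇒ a? does≡ = invert (subst (Reflects _) does≡ (proof a?))

bit : Bool → ℕ
bit true  = 1
bit false = 0

bit-xor-≤ : ∀ a b → bit (a xor b) ≤ bit a ℕ.+ bit b
bit-xor-≤ true  true  = ℕ.z≤n
bit-xor-≤ true  false = ℕₚ.≤-refl
bit-xor-≤ false _     = ℕₚ.≤-refl

length-filter-∷ : ∀ {P : Pred A 0ℓ} (P? : Decidable P) x xs →
                  length (filter P? (x ∷ xs)) ≡ bit (does (P? x)) ℕ.+ length (filter P? xs)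
length-filter-∷ P? x xs with does (P? x)
... | true  = refl
... | false = refl

module _ {n : ℕ} where

  Touches : Edge n → Fin n → Set
  Touches e w = src e ≡ w ⊎ tgt e ≡ w

  Avoids : Fin n → List (Edge n) → Set
  Avoids w T = All (λ e → ¬ Touches e w) T

  Joins⇒Touchesˡ : ∀ {e : Edge n} {u w} → Joins e u w → Touches e u
  Joins⇒Touchesˡ (inj₁ (s≡u , _)) = inj₁ s≡u
  Joins⇒Touchesˡ (inj₂ (_ , t≡u)) = inj₂ t≡u

  Joins⇒Touchesʳ : ∀ {e : Edge n} {u w} → Joins e u w → Touches e w
  Joins⇒Touchesʳ (inj₁ (_ , t≡w)) = inj₂ t≡w
  Joins⇒Touchesʳ (inj₂ (s≡w , _)) = inj₁ s≡w

  Joins-sym : ∀ {e : Edge n} {u w} → Joins e u w → Joins e w u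
  Joins-sym (inj₁ p) = inj₂ p
  Joins-sym (inj₂ p) = inj₁ p

  Joins-endpoints : ∀ {e : Edge n} {j k u w} → Joins e j k → Joins e u w → (u ≡ j × w ≡ k) ⊎ (u ≡ k × w ≡ j)
  Joins-endpoints (inj₁ (refl , refl)) (inj₁ (refl , refl)) = inj₁ (refl , refl)
  Joins-endpoints (inj₁ (refl , refl)) (inj₂ (refl , refl)) = inj₂ (refl , refl)
  Joins-endpoints (inj₂ (refl , refl)) (inj₁ (refl , refl)) = inj₂ (refl , refl)
  Joins-endpoints (inj₂ (refl , refl)) (inj₂ (refl , refl)) = inj₁ (refl , refl)

  -- Edges of G(C) are stored with src < tgt.
  orient : Fin n → Fin n → ℕ → Edge n
  orient x y l with x Finₚ.<? y
  ... | yes _ = edge x y l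
  ... | no  _ = edge y x l

  orient-joins : ∀ x y l → Joins (orient x y l) x y
  orient-joins x y l with x Finₚ.<? y
  ... | yes _ = inj₁ (refl , refl)
  ... | no  _ = inj₂ (refl , refl)

  outgoing-orient : ∀ u v x y l → outgoing u v (orient x y l) ≡ inPair u v x xor inPair u v y
  outgoing-orient u v x y l with x Finₚ.<? y
  ... | yes _ = refl
  ... | no  _ = Boolₚ.xor-comm (inPair u v y) (inPair u v x)

  orient-touches : ∀ {x y : Fin n} {l w} → Touches (orient x y l) w → x ≡ w ⊎ y ≡ w
  orient-touches {x} {y} t with x Finₚ.<? y
  ... | yes _ = t
  ... | no  _ = Sum.swap t

  inPair-≢ : ∀ {u w : Fin n} v → w ≢ u → inPair u v w ≡ does (w Fin.≟ v)
  inPair-≢ {u} {w} v w≢u with w Fin.≟ u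
  ... | yes w≡u = contradiction w≡u w≢u
  ... | no  _   = isYes≗does (w Fin.≟ v)

  inPair-left : ∀ (u v : Fin n) → inPair u v u ≡ true
  inPair-left u v with u Fin.≟ u
  ... | yes _   = refl
  ... | no  u≢u = contradiction refl u≢u

  inPair-right : ∀ (u v : Fin n) → inPair u v v ≡ true
  inPair-right u v with v Fin.≟ v
  ... | yes _   = Boolₚ.∨-zeroʳ _
  ... | no  v≢v = contradiction refl v≢v

  outgoing-orient-self : ∀ (x y : Fin n) l → outgoing x y (orient x y l) ≡ false
  outgoing-orient-self x y l = begin
    outgoing x y (orient x y l)       ≡⟨ outgoing-orient x y x y l ⟩
    inPair x y x xor inPair x y y     ≡⟨ cong₂ _xor_ (inPair-left x y) (inPair-right x y) ⟩
    false                             ∎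
    where open ≡-Reasoning

  outgoing-orient-≤ : ∀ {u x y : Fin n} v l → x ≢ u → y ≢ u →
                      bit (outgoing u v (orient x y l)) ≤ bit (does (x Fin.≟ v)) ℕ.+ bit (does (y Fin.≟ v))
  outgoing-orient-≤ {u} {x} {y} v l x≢u y≢u =
    subst (λ b → bit b ≤ _) (sym (trans (outgoing-orient u v x y l)
                                        (cong₂ _xor_ (inPair-≢ v x≢u) (inPair-≢ v y≢u))))
          (bit-xor-≤ (does (x Fin.≟ v)) (does (y Fin.≟ v)))

  nOutgoing-∷ : ∀ (u v : Fin n) e T → nOutgoing u v (e ∷ T) ≡ bit (outgoing u v e) ℕ.+ nOutgoing u v T
  nOutgoing-∷ u v e T with outgoing u v e
  ... | true  = refl
  ... | false = refl

module _ {n : ℕ} {T : List (Edge n)} where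

  weaken : ∀ {e u v} → Walk T u v → Walk (e ∷ T) u v
  weaken []             = []
  weaken (step e m J p) = step e (there m) J (weaken p)

  _++ʷ_ : ∀ {u v w} → Walk T u v → Walk T v w → Walk T u w
  []             ++ʷ q = q
  step e m J p ++ʷ q = step e m J (p ++ʷ q)

  reverseʷ : ∀ {u v} → Walk T u v → Walk T v u
  reverseʷ []             = []
  reverseʷ (step e m J p) = reverseʷ p ++ʷ step e m (Joins-sym {e = e} J) []

-- e is the only edge at j, so a closed trail through e would have to use e twice.
module PendantEdge {n} {T : List (Edge n)} {e : Edge n} {j k : Fin n}
                   (e-joins : Joins e j k) (j≢k : j ≢ k)
                   (T-avoids : Avoids j T) where

  touches-j⇒≡e : ∀ {e′} → e′ ∈ e ∷ T → Touches e′ j → e′ ≡ e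
  touches-j⇒≡e (here e′≡e) _   = e′≡e
  touches-j⇒≡e (there e′∈T) t = contradiction t (All.lookup T-avoids e′∈T)

  e-no-loop : ¬ Joins e j j
  e-no-loop J = Sum.[ j≢k ∘ proj₂ , j≢k ∘ proj₁ ] (Joins-endpoints {e = e} e-joins J)

  leaves-j-by-e : ∀ {t} (p : Walk (e ∷ T) j t) → t ≡ j ⊎ e ∈ edgesOf p
  leaves-j-by-e []             = inj₁ refl
  leaves-j-by-e (step e′ m J _) = inj₂ (here (sym (touches-j⇒≡e m (Joins⇒Touchesˡ {e = e′} J))))

  enters-j-by-e : ∀ {s} (p : Walk (e ∷ T) s j) → s ≡ j ⊎ e ∈ edgesOf p
  enters-j-by-e [] = inj₁ refl
  enters-j-by-e (step e′ m J p) with enters-j-by-e p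
  ... | inj₂ e∈p  = inj₂ (there e∈p)
  ... | inj₁ refl = inj₂ (here (sym (touches-j⇒≡e m (Joins⇒Touchesʳ {e = e′} J))))

  trail-from-e : ∀ {s w t} → Joins e s w → (p : Walk (e ∷ T) w t) → e ∉ edgesOf p →
                 s ≡ j ⊎ t ≡ j
  trail-from-e J p e∉p with Joins-endpoints {e = e} e-joins J
  ... | inj₁ (s≡j , _)  = inj₁ s≡j
  ... | inj₂ (_ , refl) with leaves-j-by-e p
  ...   | inj₁ t≡j = inj₂ t≡j
  ...   | inj₂ e∈p = contradiction e∈p e∉p

  e∈trail⇒ends-at-j : ∀ {s t} (p : Walk (e ∷ T) s t) → Unique (edgesOf p) → e ∈ edgesOf p →
                      s ≡ j ⊎ t ≡ j
  e∈trail⇒ends-at-j (step e′ m J p) (e′∉p ∷ _) (here refl) =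
    trail-from-e J p (λ e∈p → All.lookup e′∉p e∈p refl)
  e∈trail⇒ends-at-j (step e′ m J p) (e′∉p ∷ p!) (there e∈p) with e∈trail⇒ends-at-j p p! e∈p
  ... | inj₂ t≡j  = inj₂ t≡j
  ... | inj₁ refl =
    contradiction (touches-j⇒≡e m (Joins⇒Touchesʳ {e = e′} J)) (All.lookup e′∉p e∈p)

  circuit-from-e : ∀ {w} → Joins e j w → (p : Walk (e ∷ T) w j) → e ∉ edgesOf p → ⊥
  circuit-from-e J p e∉p with enters-j-by-e p
  ... | inj₁ refl = e-no-loop J
  ... | inj₂ e∈p  = e∉p e∈p

  no-trail-circuit-at-j : (p : Walk (e ∷ T) j j) → Unique (edgesOf p) → edgesOf p ≡ []
  no-trail-circuit-at-j []              _ = refl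
  no-trail-circuit-at-j (step e′ m J p) (e′∉p ∷ _) with touches-j⇒≡e m (Joins⇒Touchesˡ {e = e′} J)
  ... | refl = ⊥-elim (circuit-from-e J p (λ e∈p → All.lookup e′∉p e∈p refl))

  avoid-e : ∀ {s t} (p : Walk (e ∷ T) s t) →
            e ∈ edgesOf p ⊎ Σ (Walk T s t) (λ q → edgesOf q ≡ edgesOf p)
  avoid-e [] = inj₂ ([] , refl)
  avoid-e (step e′ (here e′≡e) J p) = inj₁ (here (sym e′≡e))
  avoid-e (step e′ (there m) J p) with avoid-e p
  ... | inj₁ e∈p     = inj₁ (there e∈p)
  ... | inj₂ (q , q≡p) = inj₂ (step e′ m J q , cong (e′ ∷_) q≡p)

  acyclic : Acyclic T → Acyclic (e ∷ T)
  acyclic T-acyclic u p p! with avoid-e p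
  ... | inj₂ (q , q≡p) = trans (sym q≡p) (T-acyclic u q (subst Unique (sym q≡p) p!))
  ... | inj₁ e∈p with e∈trail⇒ends-at-j p p! e∈p
  ...   | inj₁ refl = no-trail-circuit-at-j p p!
  ...   | inj₂ refl = no-trail-circuit-at-j p p!

orient-isEdgeOfG : ∀ C {x y : Fin (nLits C)} {l} → x ≢ y → Shares C x y l → IsEdgeOfG C (orient x y l)
orient-isEdgeOfG C {x} {y} x≢y (l∈x , l∈y) with x Finₚ.<? y
... | yes x<y = x<y , l∈x , l∈y
... | no  x≮y = Finₚ.≤∧≢⇒< (ℕₚ.≮⇒≥ x≮y) (≢-sym x≢y) , l∈y , l∈x

distinct-vertices : ∀ {n} → 2 ≤ n → Σ (Fin n) λ x → Σ (Fin n) λ y → x ≢ y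
distinct-vertices (ℕ.s≤s (ℕ.s≤s _)) = Fin.zero , Fin.suc Fin.zero , λ ()

module GreedyTree (C : Clause) where

  V : Set
  V = Fin (nLits C)

  vars : V → List ℕ
  vars v = args (litAt C v)

  ShareVar : V → V → Set
  ShareVar w j = Any (_∈ vars j) (vars w)

  _∈V?_ : (w : V) (R : List V) → Dec (w ∈ R)
  _∈V?_ = DecMembership._∈?_ Fin._≟_

  shareVar? : (w j : V) → Dec (ShareVar w j)
  shareVar? w j = Any.any? (λ x → DecMembership._∈?_ ℕ._≟_ x (vars j)) (vars w)

  record Step : Set where
    constructor attach
    field
      child parent : V
      label : ℕ
  open Step

  stepEdge : Step → Edge (nLits C)
  stepEdge s = orient (child s) (parent s) (label s)

  tree : List Step → List (Edge (nLits C))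
  tree = map stepEdge

  -- Steps are listed most recent first, hence so are the reached vertices; the root is last.
  reached : V → List Step → List V
  reached r ss = map child ss ++ r ∷ []

  record Attaches (s : Step) (R : List V) : Set where
    field
      child-new      : child s ∉ R
      parent-nearest : First (λ w → ¬ ShareVar w (child s)) (parent s ≡_) R
      shares         : Shares C (child s) (parent s) (label s)
  open Attaches

  data Greedy (r : V) : List Step → Set where
    []  : Greedy r []
    _∷_ : ∀ {s ss} → Attaches s (reached r ss) → Greedy r ss → Greedy r (s ∷ ss)

  private variable
    r j : V
    s : Step
    ss : List Step
    R : List V

  parent-reached : Attaches s R → parent s ∈ R
  parent-reached a = First.toAny (parent-nearest a)

  child≢parent : Attaches s R → child s ≢ parent s
  child≢parent {R = R} a c≡p = child-new a (subst (_∈ R) (sym c≡p) (parent-reached a))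

  attachments : Greedy r ss → All (λ s → ∃ (Attaches s)) ss
  attachments []      = []
  attachments (a ∷ g) = (_ , a) ∷ attachments g

  endpoints-reached : Greedy r ss → All (λ s → child s ∈ reached r ss × parent s ∈ reached r ss) ss
  endpoints-reached []      = []
  endpoints-reached (a ∷ g) =
    (here refl , there (parent-reached a)) ∷ All.map (Product.map there there) (endpoints-reached g)

  reached-unique : Greedy r ss → Unique (reached r ss)
  reached-unique []                    = [] ∷ []
  reached-unique {r} {s ∷ ss} (a ∷ g) =
    All.tabulate (λ w∈ c≡w → child-new a (subst (_∈ reached r ss) (sym c≡w) w∈)) ∷ reached-unique g

  steps-avoid : Greedy r ss → j ∉ reached r ss → All (λ s → child s ≢ j × parent s ≢ j) ss
  steps-avoid {r} {ss} {j} g j∉ = All.map (Product.map ≢j ≢j) (endpoints-reached g)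
    where
    ≢j : ∀ {w} → w ∈ reached r ss → w ≢ j
    ≢j w∈ refl = j∉ w∈

  tree-avoids : All (λ s → child s ≢ j × parent s ≢ j) ss → Avoids j (tree ss)
  tree-avoids = All.map⁺ ∘ All.map (λ (c≢j , p≢j) t → Sum.[ c≢j , p≢j ] (orient-touches t))

  tree-acyclic : Greedy r ss → Acyclic (tree ss)
  tree-acyclic []      _ []               _ = refl
  tree-acyclic []      _ (step _ () _ _) _
  tree-acyclic (a ∷ g) = PendantEdge.acyclic (orient-joins _ _ _) (child≢parent a)
                           (tree-avoids (steps-avoid g (child-new a))) (tree-acyclic g)

  tree-unique : Greedy r ss → Unique (tree ss)
  tree-unique []              = []
  tree-unique {ss = s ∷ _} (a ∷ g) =
    All.map (λ ¬touch e≡e′ → ¬touch (subst (λ e → Touches e (child s)) e≡e′ s-touches))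
            (tree-avoids (steps-avoid g (child-new a)))
    ∷ tree-unique g
    where s-touches = Joins⇒Touchesˡ {e = stepEdge s} (orient-joins (child s) (parent s) (label s))

  walk-to-root : Greedy r ss → ∀ {w} → w ∈ reached r ss → Walk (tree ss) w r
  walk-to-root []      (here refl) = []
  walk-to-root (a ∷ g) (here refl) =
    step _ (here refl) (orient-joins _ _ _) (weaken (walk-to-root g (parent-reached a)))
  walk-to-root (a ∷ g) (there w∈)  = weaken (walk-to-root g w∈)

  tree-spanning : Greedy r ss → (∀ w → w ∈ reached r ss) → IsSpanningTree C (tree ss)
  tree-spanning g covers =
    All.map⁺ (All.map (λ (_ , a) → orient-isEdgeOfG C (child≢parent a) (shares a)) (attachments g)) ,
    tree-unique g ,
    (λ u v → walk-to-root g (covers u) ++ʷ reverseʷ (walk-to-root g (covers v))) ,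
    tree-acyclic g

  child-precedes-parent : Greedy r ss → All (λ s → First (parent s ≢_) (child s ≡_) (reached r ss)) ss
  child-precedes-parent []      = []
  child-precedes-parent (a ∷ g) =
    [ refl ] ∷ All.zipWith (λ ((_ , p≢c) , f) → p≢c ∷ f)
                           (steps-avoid g (child-new a) , child-precedes-parent g)

  childrenOf : V → List Step → List Step
  childrenOf v = filter (λ s → parent s Fin.≟ v)

  childLabels : V → List Step → List ℕ
  childLabels v ss = map label (childrenOf v ss)

  -- child s′ would share that label with child s and was reached after parent s,
  -- so the greedy rule would not have chosen parent s as the parent of child s.
  sibling-label-≢ : Attaches s (reached r ss) → Greedy r ss → ∀ {s′} → s′ ∈ ss →
                    parent s′ ≡ parent s → label s′ ≢ label s
  sibling-label-≢ {s} a g {s′} s′∈ p′≡p l′≡l =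
    First-precedes (child≢parent a′) nearest (All.lookup (child-precedes-parent g) s′∈)
      (Any.map (λ l′≡x → subst (_∈ vars (child s)) l′≡x
                            (subst (_∈ vars (child s)) (sym l′≡l) (proj₁ (shares a))))
               (proj₁ (shares a′)))
    where
    a′ = proj₂ (All.lookup (attachments g) s′∈)
    nearest = subst (λ p → First (λ w → ¬ ShareVar w (child s)) (p ≡_) _) (sym p′≡p) (parent-nearest a)

  childLabels-unique : Greedy r ss → ∀ v → Unique (childLabels v ss)
  childLabels-unique []                   v = []
  childLabels-unique {ss = s ∷ ss} (a ∷ g) v with parent s Fin.≟ v
  ... | no  _    = childLabels-unique g v
  ... | yes refl = All.tabulate sibling-labels-≢ ∷ childLabels-unique g v
    where
    sibling-labels-≢ : ∀ {l} → l ∈ childLabels (parent s) ss → label s ≢ l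
    sibling-labels-≢ l∈ with ∈-map⁻ label l∈
    ... | s′ , s′∈ , refl with ∈-filter⁻ (λ t → parent t Fin.≟ parent s) s′∈
    ...   | s′∈ss , p′≡p = ≢-sym (sibling-label-≢ a g s′∈ss p′≡p)

  childLabels⊆vars : Greedy r ss → ∀ {v l} → l ∈ childLabels v ss → l ∈ vars v
  childLabels⊆vars {ss = ss} g {v} l∈ with ∈-map⁻ label l∈
  ... | s , s∈ , refl with ∈-filter⁻ (λ t → parent t Fin.≟ v) {xs = ss} s∈
  ...   | s∈ss , refl = proj₂ (shares (proj₂ (All.lookup (attachments g) s∈ss)))

  arrivalsAt : V → List Step → List Step
  arrivalsAt v = filter (λ s → child s Fin.≟ v)

  arrivalsAt-≤1 : Greedy r ss → ∀ {v} → length (arrivalsAt v ss) ≤ 1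
  arrivalsAt-≤1 []                           = ℕ.z≤n
  arrivalsAt-≤1 {ss = s ∷ ss} (a ∷ g) {v} with child s Fin.≟ v
  ... | no  _    = arrivalsAt-≤1 g
  ... | yes refl = ℕₚ.≤-reflexive (cong (ℕ.suc ∘ length)
                     (Listₚ.filter-none (λ t → child t Fin.≟ child s)
                                        (All.map proj₁ (steps-avoid g (child-new a)))))

  nOutgoing-tree-≤ : ∀ {u v} → All (λ s → child s ≢ u × parent s ≢ u) ss →
                     nOutgoing u v (tree ss) ≤ length (arrivalsAt v ss) ℕ.+ length (childrenOf v ss)
  nOutgoing-tree-≤ [] = ℕ.z≤n
  nOutgoing-tree-≤ {s ∷ ss} {u} {v} ((c≢u , p≢u) ∷ avoid) = begin
    nOutgoing u v (stepEdge s ∷ tree ss)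
      ≡⟨ nOutgoing-∷ u v (stepEdge s) (tree ss) ⟩
    bit (outgoing u v (stepEdge s)) ℕ.+ nOutgoing u v (tree ss)
      ≤⟨ ℕₚ.+-mono-≤ (outgoing-orient-≤ v (label s) c≢u p≢u) (nOutgoing-tree-≤ avoid) ⟩
    (bit c ℕ.+ bit p) ℕ.+ (length (arrivalsAt v ss) ℕ.+ length (childrenOf v ss))
      ≡⟨ interchange (bit c) (bit p) _ _ ⟩
    (bit c ℕ.+ length (arrivalsAt v ss)) ℕ.+ (bit p ℕ.+ length (childrenOf v ss))
      ≡⟨ cong₂ ℕ._+_ (length-filter-∷ (λ t → child t Fin.≟ v) s ss)
                     (length-filter-∷ (λ t → parent t Fin.≟ v) s ss) ⟨
    length (arrivalsAt v (s ∷ ss)) ℕ.+ length (childrenOf v (s ∷ ss))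
      ∎
    where
    open ℕₚ.≤-Reasoning
    c = does (child s Fin.≟ v)
    p = does (parent s Fin.≟ v)

  -- The edge {u, v} is not outgoing but is counted among the child labels of v,
  -- which pays for the (at most one) edge by which v was itself attached.
  attached-pair-light : Greedy r (s ∷ ss) →
                        nOutgoing (child s) (parent s) (tree (s ∷ ss)) ≤ length (vars (parent s))
  attached-pair-light {s = s} {ss} g@(a ∷ g′) = begin
    nOutgoing u v (stepEdge s ∷ tree ss)
      ≡⟨ nOutgoing-∷ u v (stepEdge s) (tree ss) ⟩
    bit (outgoing u v (stepEdge s)) ℕ.+ nOutgoing u v (tree ss)
      ≡⟨ cong (λ b → bit b ℕ.+ nOutgoing u v (tree ss)) (outgoing-orient-self u v (label s)) ⟩
    nOutgoing u v (tree ss)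
      ≤⟨ nOutgoing-tree-≤ (steps-avoid g′ (child-new a)) ⟩
    length (arrivalsAt v ss) ℕ.+ length (childrenOf v ss)
      ≤⟨ ℕₚ.+-monoˡ-≤ _ (arrivalsAt-≤1 g′) ⟩
    length (s ∷ childrenOf v ss)
      ≡⟨ cong length (Listₚ.filter-accept (λ t → parent t Fin.≟ v) refl) ⟨
    length (childrenOf v (s ∷ ss))
      ≡⟨ Listₚ.length-map label (childrenOf v (s ∷ ss)) ⟨
    length (childLabels v (s ∷ ss))
      ≤⟨ Unique⇒length-≤ (childLabels-unique g v) (childLabels⊆vars g) ⟩
    length (vars v)
      ∎
    where
    open ℕₚ.≤-Reasoning
    u = child s
    v = parent s

  crossing-pair : IsConnectedClause C → ∀ R {i j} → i ∈ R → j ∉ R →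
                  Σ V λ i′ → Σ V λ j′ → i′ ∈ R × j′ ∉ R × ShareVar i′ j′
  crossing-pair connected R {i} {j} i∈R j∉R
    with connected (λ w → does (w ∈V? R)) (i , dec-true (i ∈V? R) i∈R) (j , dec-false (j ∈V? R) j∉R)
  ... | i′ , j′ , x , i′∈R , j′∉R , x∈i′ , x∈j′ =
    i′ , j′ , does-true⇒ (i′ ∈V? R) i′∈R , does-false⇒ (j′ ∈V? R) j′∉R , lose x∈i′ x∈j′

  module Growth (connected : IsConnectedClause C) (r : V) where

    grow : Greedy r ss → ∀ {j} → j ∉ reached r ss → Σ Step λ s → Greedy r (s ∷ ss)
    grow {ss} g j∉
      with crossing-pair connected (reached r ss) (∈-++⁺ʳ (map child ss) (here refl)) j∉
    ... | i , j′ , i∈ , j′∉ , i~j′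
      with First.first (λ w → Sum.swap (toSum (shareVar? w j′))) (reached r ss)
    ...   | inj₂ none-share = contradiction i~j′ (All.lookup none-share i∈)
    ...   | inj₁ f with First-witness f
    ...     | k , k~j′ , nearest with find k~j′
    ...       | x , x∈k , x∈j′ =
      attach j′ k x , record { child-new = j′∉ ; parent-nearest = nearest ; shares = x∈j′ , x∈k } ∷ g

    grow-until-spanning : ∀ fuel → Greedy r ss → nLits C ≤ length (reached r ss) ℕ.+ fuel →
                          Σ (List Step) λ ss′ → Greedy r ss′ × (∀ w → w ∈ reached r ss′)
    grow-until-spanning ℕ.zero g n≤ =
      _ , g , Unique⇒complete (reached-unique g) (subst (nLits C ≤_) (ℕₚ.+-identityʳ _) n≤)
    grow-until-spanning {ss} (ℕ.suc fuel) g n≤ with Finₚ.all? {n = nLits C} (_∈V? reached r ss)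
    ... | yes covers = _ , g , covers
    ... | no ¬covers with Finₚ.¬∀⟶∃¬ (nLits C) _ (_∈V? reached r ss) ¬covers
    ...   | j , j∉ with grow g j∉
    ...     | s , g′ = grow-until-spanning fuel g′ (subst (nLits C ≤_) (ℕₚ.+-suc _ fuel) n≤)

    spanning-greedy : Σ (List Step) λ ss → Greedy r ss × (∀ w → w ∈ reached r ss)
    spanning-greedy = grow-until-spanning (nLits C) [] (ℕₚ.n≤1+n _)

  light-spanning-tree : IsConnectedClause C → 2 ≤ nLits C →
    ∃ λ T → IsSpanningTree C T ×
      (∃ λ u → ∃ λ v → ∃ λ e → e ∈ T × Joins e u v × nOutgoing u v T ≤ length (vars v))
  light-spanning-tree connected 2≤n with distinct-vertices 2≤n
  ... | r , w , r≢w with Growth.spanning-greedy connected r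
  ...   | [] , _ , covers = contradiction (covers w) λ { (here w≡r) → r≢w (sym w≡r) }
  ...   | s ∷ ss , g , covers =
    tree (s ∷ ss) , tree-spanning g covers , child s , parent s , stepEdge s , here refl ,
    orient-joins (child s) (parent s) (label s) , attached-pair-light g

mainTheorem3 : (a : ℕ) → 1 ≤ a → (C : Clause) → InHc a C → 2 ≤ nLits C →
    ∃ λ T → IsSpanningTree C T ×
      (∃ λ u → ∃ λ v → ∃ λ e → e ∈ T × Joins e u v × nOutgoing u v T ≤ a)
mainTheorem3 a _ C (arities , connected) 2≤n
  with GreedyTree.light-spanning-tree C connected 2≤n
... | T , spanning , u , v , e , e∈T , joins , light =
  T , spanning , u , v , e , e∈T , joins ,
  ℕₚ.≤-trans light (proj₂ (All.lookup arities (∈-lookup v)))
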